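{- Let $\pi\in S_n$ and let $i>j$ be values such that $i$ appears to the left of $j$ in $\pi$ (so $(i,j)$ is an inversion), where $i$ lies in the descending run $i_1i_2\cdots i_s$ of $\pi$ and $j$ lies in a different descending run $j_1j_2\cdots j_t$. If $[i_s,i_1]\cap[j_t,j_1]=\emptyset$, then there exist descending runs $D_1,D_2,\ldots,D_m$ ($m\ge 1$) of $\pi$, located in $\pi$ between $i_s$ and $j_1$, such that, writing $I(D)=[\min D,\max D]$ for a descending run $D$, we have $[i_s,i_1]\cap I(D_1)\ne\emptyset$, $I(D_m)\cap[j_t,j_1]\ne\emptyset$, and $I(D_k)\cap I(D_{k+1})\neq\emptyset$ for $1\le k\le m-1$.
   Context: Permutations are written in one-line notation $\pi=\pi_1\cdots\pi_n$. A descending run of $\pi$ is a maximal consecutive decreasing sequence $\pi_r\pi_{r+1}\cdots\pi_s$ (maximal: $r=1$ or $\pi_r>\pi_{r-1}$, and $s=n$ or $\pi_s<\pi_{s+1}$); every entry lies in exactly one descending run. For integers $a\le b$, $[a,b]=\{c\in\mathbb{Z}: a\le c\le b\}$. -}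

module Defs where

open import Data.Nat using (ℕ; suc; _≤_; _<_)
open import Data.Fin using (Fin; toℕ)
open import Data.Fin.Permutation using (Permutation′; _⟨$⟩ʳ_)
open import Data.Product using (_×_; ∃; _,_)
open import Relation.Binary.PropositionalEquality using (_≡_)

-- Positions and values are both Fin n (0-based; values 0..n-1 stand for 1..n).
-- π ⟨$⟩ʳ p is the entry π_p at position p.

val : ∀ {n} → Permutation′ n → Fin n → ℕ
val π p = toℕ (π ⟨$⟩ʳ p)

record IsDescRun {n : ℕ} (π : Permutation′ n) (r s : Fin n) : Set where
  field
    r≤s        : toℕ r ≤ toℕ s
    decreasing : ∀ (p q : Fin n) → toℕ r ≤ toℕ p → suc (toℕ p) ≡ toℕ q → toℕ q ≤ toℕ s
                 → val π q < val π p
    maxLeft    : ∀ (p : Fin n) → suc (toℕ p) ≡ toℕ r → val π p < val π r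
    maxRight   : ∀ (q : Fin n) → toℕ q ≡ suc (toℕ s) → val π s < val π q

Meet : ℕ → ℕ → ℕ → ℕ → Set
Meet a b c d = ∃ λ x → (a ≤ x × x ≤ b) × (c ≤ x × x ≤ d)

-- I(D) for the run D occupying positions r..s is [π_s, π_r] = [min D, max D]
RunsMeet : ∀ {n} → Permutation′ n → (Fin n × Fin n) → (Fin n × Fin n) → Set
RunsMeet π (r , s) (r' , s') = Meet (val π s) (val π r) (val π s') (val π r')

module Submission where

-- Let the inversion (π_p, π_q) join the run I = [ri, si] to a different run
-- J = [rj, sj] whose value intervals are disjoint.  First, two distinct runs
-- occupy disjoint blocks of positions, so si < rj; and since π_q < π_p while
-- the intervals are disjoint, I(J) lies entirely below I(I): π_rj < π_si.
--
-- The chain is found by scanning the positions t = rj, rj-1, ..., si+1 from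
-- right to left, maintaining a bound M ≥ π_t, π_rj such that every value x in
-- [π_rj, M] is "reachable": x ∈ I(J), or some chain of runs strictly between
-- I and J starts with an interval containing x and ends meeting I(J).  When π_t
-- exceeds M, the run of t lies between I and J and its interval contains both
-- M and π_t, so prepending it to the chain for M makes all of [M, π_t]
-- reachable.  At t = si+1 the bound exceeds π_si (si ends a run), so π_si is
-- reachable, and it cannot lie in I(J); its chain is the one required.

open import Defs
open import Data.Nat using (ℕ; _<_; _≤_; _∸_; _+_; _≤?_; _<?_) renaming (suc to 1+)
open import Data.Nat.Properties
open import Data.Fin using (Fin; toℕ; zero; suc; fromℕ; inject₁; fromℕ<)
open import Data.Fin.Properties using (toℕ-fromℕ<; toℕ-injective; toℕ<n)
open import Data.Fin.Permutation using (Permutation′; _⟨$⟩ˡ_; inverseˡ)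
open import Data.Product using (_×_; Σ; ∃; _,_; proj₁; proj₂)
open import Data.Sum using (_⊎_; inj₁; inj₂)
open import Data.Empty using (⊥-elim)
open import Relation.Binary.PropositionalEquality using (_≡_; refl; sym; trans; cong; subst; subst₂)
open import Relation.Nullary using (¬_; yes; no)
open import Relation.Binary using (tri<; tri≈; tri>)

disjoint-below : ∀ {a b c d} → a ≤ b → c ≤ d → c ≤ b → ¬ Meet a b c d → d < a
disjoint-below {a} {b} {c} {d} a≤b c≤d c≤b apart with a ≤? c
... | yes a≤c = ⊥-elim (apart (c , (a≤c , c≤b) , (≤-refl , c≤d)))
... | no a≰c = ≰⇒> λ a≤d → apart (a , (≤-refl , a≤b) , (<⇒≤ (≰⇒> a≰c) , a≤d))

summand-≤ : ∀ m {d o} → m + d ≡ o → m ≤ o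
summand-≤ m {d} m+d≡o = subst (m ≤_) m+d≡o (m≤m+n m d)

module Runs {n : ℕ} (π : Permutation′ n) where

  v : Fin n → ℕ
  v = val π

  v-injective : ∀ {a b} → v a ≡ v b → a ≡ b
  v-injective e = trans (sym (inverseˡ π)) (trans (cong (π ⟨$⟩ˡ_) (toℕ-injective e)) (inverseˡ π))

  _∈I_ : ℕ → Fin n × Fin n → Set
  x ∈I (r , s) = v s ≤ x × x ≤ v r

  position : (k : ℕ) → k < n → ∃ λ c → toℕ c ≡ k
  position k k<n = fromℕ< k<n , toℕ-fromℕ< k<n

  left-neighbour : ∀ {m} (b : Fin n) → m < toℕ b → ∃ λ c → 1+ (toℕ c) ≡ toℕ b × m ≤ toℕ c
  left-neighbour b m<b with toℕ b in b≡ | m<b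
  ... | 1+ k | m<k+1 with position k (≤-<-trans (n≤1+n k) (subst (_< n) b≡ (toℕ<n b)))
  ...   | c , c≡k = c , cong 1+ c≡k , subst (_ ≤_) (sym c≡k) (≤-pred m<k+1)

  ascent : ∀ {p q} → 1+ (toℕ p) ≡ toℕ q → ¬ (v q < v p) → v p < v q
  ascent p+1≡q q≮p = ≤∧≢⇒< (≮⇒≥ q≮p) λ e → 1+n≢n (trans p+1≡q (sym (cong toℕ (v-injective e))))

  DescendsOn : Fin n → Fin n → Set
  DescendsOn r s = ∀ (p q : Fin n) → toℕ r ≤ toℕ p → 1+ (toℕ p) ≡ toℕ q → toℕ q ≤ toℕ s → v q < v p

  StartsRun : Fin n → Set
  StartsRun r = ∀ (p : Fin n) → 1+ (toℕ p) ≡ toℕ r → v p < v r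

  EndsRun : Fin n → Set
  EndsRun s = ∀ (q : Fin n) → toℕ q ≡ 1+ (toℕ s) → v s < v q

  descendsOn-refl : ∀ t → DescendsOn t t
  descendsOn-refl t p q t≤p p+1≡q q≤t = ⊥-elim (1+n≰n (≤-trans (subst (_≤ toℕ t) (sym p+1≡q) q≤t) t≤p))

  descendsOn-step : ∀ {p q} → 1+ (toℕ p) ≡ toℕ q → v q < v p → DescendsOn p q
  descendsOn-step {p} {q} p+1≡q desc a b p≤a a+1≡b b≤q = subst₂ (λ x y → v y < v x) (sym a≡p) (sym b≡q) desc
    where
      a≡p : a ≡ p
      a≡p = toℕ-injective (≤-antisym (≤-pred (subst₂ _≤_ (sym a+1≡b) (sym p+1≡q) b≤q)) p≤a)
      b≡q : b ≡ q
      b≡q = toℕ-injective (trans (sym a+1≡b) (trans (cong (λ x → 1+ (toℕ x)) a≡p) p+1≡q))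

  descendsOn-join : ∀ {r t s} → DescendsOn r t → DescendsOn t s → DescendsOn r s
  descendsOn-join {t = t} left right p q r≤p p+1≡q q≤s with toℕ q ≤? toℕ t
  ... | yes q≤t = left p q r≤p p+1≡q q≤t
  ... | no q≰t = right p q (≤-pred (subst (toℕ t <_) (sym p+1≡q) (≰⇒> q≰t))) p+1≡q q≤s

  run-start : ∀ k (t : Fin n) → toℕ t ≡ k → ∃ λ r → toℕ r ≤ toℕ t × DescendsOn r t × StartsRun r
  run-start 0 t t≡0 = t , ≤-refl , descendsOn-refl t , λ p p+1≡t → ⊥-elim (1+n≢0 (trans p+1≡t t≡0))
  run-start (1+ k) t t≡k+1 with position k (≤-<-trans (n≤1+n k) (subst (_< n) t≡k+1 (toℕ<n t)))
  ... | t′ , t′≡k with v t <? v t′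
  ...   | yes desc = extend (run-start k t′ t′≡k)
    where
      extend : (∃ λ r → toℕ r ≤ toℕ t′ × DescendsOn r t′ × StartsRun r)
             → ∃ λ r → toℕ r ≤ toℕ t × DescendsOn r t × StartsRun r
      extend (r , r≤t′ , D , S) =
        r , ≤-trans r≤t′ (subst₂ _≤_ (sym t′≡k) (sym t≡k+1) (n≤1+n k)) ,
        descendsOn-join D (descendsOn-step (trans (cong 1+ t′≡k) (sym t≡k+1)) desc) , S
  ...   | no ¬desc = t , ≤-refl , descendsOn-refl t , starts
    where
      starts : StartsRun t
      starts p p+1≡t = subst (λ x → v x < v t) (sym p≡t′)
                         (ascent (trans (cong 1+ t′≡k) (sym t≡k+1)) ¬desc)
        where
          p≡t′ : p ≡ t′
          p≡t′ = toℕ-injective (suc-injective (trans p+1≡t (trans t≡k+1 (cong 1+ (sym t′≡k)))))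

  run-end : ∀ d (t : Fin n) → d + toℕ t ≡ n → ∃ λ s → toℕ t ≤ toℕ s × DescendsOn t s × EndsRun s
  run-end 0 t t≡n = ⊥-elim (<-irrefl t≡n (toℕ<n t))
  run-end (1+ d) t e with 1+ (toℕ t) <? n
  ... | no last = t , ≤-refl , descendsOn-refl t , λ q q≡t+1 → ⊥-elim (last (subst (_< n) q≡t+1 (toℕ<n q)))
  ... | yes t+1<n with position (1+ (toℕ t)) t+1<n
  ...   | t′ , t′≡t+1 with v t′ <? v t
  ...     | yes desc = extend (run-end d t′ (trans (cong (d +_) t′≡t+1) (trans (+-suc d (toℕ t)) e)))
    where
      extend : (∃ λ s → toℕ t′ ≤ toℕ s × DescendsOn t′ s × EndsRun s)
             → ∃ λ s → toℕ t ≤ toℕ s × DescendsOn t s × EndsRun s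
      extend (s , t′≤s , D , E) =
        s , ≤-trans (n≤1+n (toℕ t)) (subst (_≤ toℕ s) t′≡t+1 t′≤s) ,
        descendsOn-join (descendsOn-step (sym t′≡t+1) desc) D , E
  ...     | no ¬desc = t , ≤-refl , descendsOn-refl t , ends
    where
      ends : EndsRun t
      ends q q≡t+1 = subst (λ x → v t < v x) (toℕ-injective (trans t′≡t+1 (sym q≡t+1)))
                       (ascent (sym t′≡t+1) ¬desc)

  run-containing : (t : Fin n) → Σ (Fin n) λ r → Σ (Fin n) λ s
                 → IsDescRun π r s × toℕ r ≤ toℕ t × toℕ t ≤ toℕ s
  run-containing t with run-start (toℕ t) t refl | run-end (n ∸ toℕ t) t (m∸n+n≡m (<⇒≤ (toℕ<n t)))
  ... | r , r≤t , left , starts | s , t≤s , right , ends =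
    r , s , record { r≤s = ≤-trans r≤t t≤s ; decreasing = descendsOn-join left right
                   ; maxLeft = starts ; maxRight = ends } , r≤t , t≤s

  descendsOn-antitone : ∀ {r s} → DescendsOn r s → ∀ d {a b : Fin n} → toℕ a + d ≡ toℕ b
                      → toℕ r ≤ toℕ a → toℕ b ≤ toℕ s → v b ≤ v a
  descendsOn-antitone D 0 {a} {b} e _ _ =
    ≤-reflexive (cong v (toℕ-injective (trans (sym e) (+-identityʳ (toℕ a)))))
  descendsOn-antitone {r} {s} D (1+ d) {a} {b} e r≤a b≤s
    with left-neighbour b (≤-reflexive (trans (sym (+-suc (toℕ a) d)) e))
  ... | c , c+1≡b , a+d≤c = ≤-trans (<⇒≤ (D c b r≤c c+1≡b b≤s)) (descendsOn-antitone D d a+d≡c r≤a c≤s)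
    where
      a+d≡c : toℕ a + d ≡ toℕ c
      a+d≡c = suc-injective (trans (trans (sym (+-suc (toℕ a) d)) e) (sym c+1≡b))
      r≤c : toℕ r ≤ toℕ c
      r≤c = ≤-trans r≤a (≤-trans (m≤m+n (toℕ a) d) a+d≤c)
      c≤s : toℕ c ≤ toℕ s
      c≤s = ≤-trans (n≤1+n (toℕ c)) (subst (_≤ toℕ s) (sym c+1≡b) b≤s)

  run-antitone : ∀ {r s a b} → IsDescRun π r s → toℕ r ≤ toℕ a → toℕ a ≤ toℕ b → toℕ b ≤ toℕ s → v b ≤ v a
  run-antitone {a = a} {b} R r≤a a≤b b≤s =
    descendsOn-antitone (IsDescRun.decreasing R) (toℕ b ∸ toℕ a) (m+[n∸m]≡n a≤b) r≤a b≤s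

  run-interval : ∀ {r s t} → IsDescRun π r s → toℕ r ≤ toℕ t → toℕ t ≤ toℕ s → v t ∈I (r , s)
  run-interval R r≤t t≤s = run-antitone R r≤t t≤s ≤-refl , run-antitone R ≤-refl r≤t t≤s

  -- a run cannot start strictly inside another run (its left end is an ascent)
  start-not-inside : ∀ {r₁ s₁ r₂ s₂} → IsDescRun π r₁ s₁ → IsDescRun π r₂ s₂
                   → toℕ r₁ < toℕ r₂ → ¬ (toℕ r₂ ≤ toℕ s₁)
  start-not-inside {r₂ = r₂} R₁ R₂ r₁<r₂ r₂≤s₁ with left-neighbour r₂ r₁<r₂
  ... | c , c+1≡r₂ , r₁≤c =
    <-asym (IsDescRun.decreasing R₁ c r₂ r₁≤c c+1≡r₂ r₂≤s₁) (IsDescRun.maxLeft R₂ c c+1≡r₂)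

  -- a run cannot end strictly inside another run (its right end is an ascent)
  end-not-inside : ∀ {r₁ s₁ r₂ s₂} → IsDescRun π r₁ s₁ → IsDescRun π r₂ s₂
                 → toℕ r₂ ≤ toℕ s₁ → ¬ (toℕ s₁ < toℕ s₂)
  end-not-inside {s₁ = s₁} {s₂ = s₂} R₁ R₂ r₂≤s₁ s₁<s₂
    with position (1+ (toℕ s₁)) (≤-<-trans s₁<s₂ (toℕ<n s₂))
  ... | c , c≡s₁+1 =
    <-asym (IsDescRun.decreasing R₂ s₁ c r₂≤s₁ (sym c≡s₁+1) (subst (_≤ toℕ s₂) (sym c≡s₁+1) s₁<s₂))
           (IsDescRun.maxRight R₁ c c≡s₁+1)

  same-start-same-end : ∀ {r₁ s₁ r₂ s₂} → IsDescRun π r₁ s₁ → IsDescRun π r₂ s₂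
                      → toℕ r₁ ≡ toℕ r₂ → toℕ s₁ ≡ toℕ s₂
  same-start-same-end R₁ R₂ r₁≡r₂ = ≤-antisym
    (≮⇒≥ (end-not-inside R₂ R₁ (subst (_≤ _) (sym r₁≡r₂) (IsDescRun.r≤s R₂))))
    (≮⇒≥ (end-not-inside R₁ R₂ (subst (_≤ _) r₁≡r₂ (IsDescRun.r≤s R₁))))

  runs-ordered : ∀ {r₁ s₁ r₂ s₂} → IsDescRun π r₁ s₁ → IsDescRun π r₂ s₂ → toℕ r₁ ≤ toℕ s₂
               → toℕ s₁ < toℕ r₂ ⊎ (r₁ ≡ r₂ × s₁ ≡ s₂)
  runs-ordered {r₁} {s₁} {r₂} {s₂} R₁ R₂ r₁≤s₂ with <-cmp (toℕ r₁) (toℕ r₂)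
  ... | tri< r₁<r₂ _ _ = inj₁ (≰⇒> (start-not-inside R₁ R₂ r₁<r₂))
  ... | tri≈ _ r₁≡r₂ _ = inj₂ (toℕ-injective r₁≡r₂ , toℕ-injective (same-start-same-end R₁ R₂ r₁≡r₂))
  ... | tri> _ _ r₂<r₁ = ⊥-elim (start-not-inside R₂ R₁ r₂<r₁ r₁≤s₂)

distinct-runs-ordered : ∀ {n} (π : Permutation′ n) {p q ri si rj sj : Fin n} → toℕ p < toℕ q
  → IsDescRun π ri si → toℕ ri ≤ toℕ p
  → IsDescRun π rj sj → toℕ q ≤ toℕ sj
  → ¬ (ri ≡ rj × si ≡ sj) → toℕ si < toℕ rj
distinct-runs-ordered π p<q Ri ri≤p Rj q≤sj distinct
  with Runs.runs-ordered π Ri Rj (≤-trans ri≤p (≤-trans (<⇒≤ p<q) q≤sj))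
... | inj₁ si<rj = si<rj
... | inj₂ same = ⊥-elim (distinct same)

module Linking {n : ℕ} (π : Permutation′ n) (ri si rj sj : Fin n)
               (Ri : IsDescRun π ri si) (Rj : IsDescRun π rj sj) (si<rj : toℕ si < toℕ rj) where
  open Runs π

  Between : Fin n × Fin n → Set
  Between D = IsDescRun π (proj₁ D) (proj₂ D) × toℕ si < toℕ (proj₁ D) × toℕ (proj₂ D) < toℕ rj

  Chain : ℕ → Set
  Chain x = ∃ λ (k : ℕ) → Σ (Fin (1+ k) → Fin n × Fin n) λ D
    → (∀ a → Between (D a))
    × x ∈I D zero
    × RunsMeet π (D (fromℕ k)) (rj , sj)
    × (∀ (a : Fin k) → RunsMeet π (D (inject₁ a)) (D (suc a)))

  Reach : ℕ → Set
  Reach x = x ∈I (rj , sj) ⊎ Chain x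

  prepend : ∀ {E x y} → Between E → x ∈I E → y ∈I E → Reach y → Chain x
  prepend {E} {y = y} B x∈E y∈E (inj₁ y∈J) = 0 , (λ _ → E) , (λ _ → B) , x∈E , (y , y∈E , y∈J) , λ ()
  prepend {E} {y = y} B x∈E y∈E (inj₂ (k , D , between , y∈D₀ , last , links)) =
    1+ k , E∷D , E∷D-between , x∈E , last , E∷D-links
    where
      E∷D : Fin (1+ (1+ k)) → Fin n × Fin n
      E∷D zero = E
      E∷D (suc a) = D a
      E∷D-between : ∀ a → Between (E∷D a)
      E∷D-between zero = B
      E∷D-between (suc a) = between a
      E∷D-links : ∀ (a : Fin (1+ k)) → RunsMeet π (E∷D (inject₁ a)) (E∷D (suc a))
      E∷D-links zero = y , y∈E , y∈D₀
      E∷D-links (suc a) = links a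

  run-between : ∀ {r s t : Fin n} → IsDescRun π r s → toℕ r ≤ toℕ t → toℕ t ≤ toℕ s
              → toℕ si < toℕ t → toℕ t < toℕ rj → Between (r , s)
  run-between {r} {s} {t} R r≤t t≤s si<t t<rj = R , after-I , before-J
    where
      after-I : toℕ si < toℕ r
      after-I with runs-ordered Ri R (≤-trans (IsDescRun.r≤s Ri) (≤-trans (<⇒≤ si<t) t≤s))
      ... | inj₁ si<r = si<r
      ... | inj₂ (_ , refl) = ⊥-elim (<⇒≱ si<t t≤s)
      before-J : toℕ s < toℕ rj
      before-J with runs-ordered R Rj (≤-trans r≤t (≤-trans (<⇒≤ t<rj) (IsDescRun.r≤s Rj)))
      ... | inj₁ s<rj = s<rj
      ... | inj₂ (refl , _) = ⊥-elim (<⇒≱ t<rj r≤t)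

  Covered : Fin n → Set
  Covered t = Σ ℕ λ M → v t ≤ M × v rj ≤ M × (∀ x → v rj ≤ x → x ≤ M → Reach x)

  covered-rj : Covered rj
  covered-rj = v rj , ≤-refl , ≤-refl ,
    λ x rj≤x x≤rj → inj₁ (≤-trans (proj₁ (run-interval Rj ≤-refl (IsDescRun.r≤s Rj))) rj≤x , x≤rj)

  -- if π_t exceeds the bound M of position t+1, then t is not the end of its
  -- run, and that run's interval contains [M, π_t]
  raise : ∀ {t u r s : Fin n} {M} → 1+ (toℕ t) ≡ toℕ u → v u ≤ M → M < v t
        → IsDescRun π r s → toℕ r ≤ toℕ t → toℕ t ≤ toℕ s → ∀ {x} → M ≤ x → x ≤ v t → x ∈I (r , s)
  raise {t} {u} {r} {s} t+1≡u u≤M M<t R r≤t t≤s M≤x x≤t =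
    ≤-trans (≤-trans (proj₁ (run-interval R (≤-trans r≤t (≤-trans (n≤1+n _) (≤-reflexive t+1≡u))) u≤s)) u≤M) M≤x ,
    ≤-trans x≤t (proj₂ (run-interval R r≤t t≤s))
    where
      u≤s : toℕ u ≤ toℕ s
      u≤s with m≤n⇒m<n∨m≡n t≤s
      ... | inj₁ t<s = subst (_≤ toℕ s) t+1≡u t<s
      ... | inj₂ t≡s = ⊥-elim (<-asym (≤-<-trans u≤M M<t)
                         (subst (λ x → v x < v u) (sym (toℕ-injective t≡s))
                                (IsDescRun.maxRight R u (trans (sym t+1≡u) (cong 1+ t≡s)))))

  covered-step : ∀ {t u : Fin n} → 1+ (toℕ t) ≡ toℕ u → toℕ si < toℕ t → toℕ u ≤ toℕ rj → Covered u → Covered t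
  covered-step {t} {u} t+1≡u si<t u≤rj (M , u≤M , rj≤M , reach) with v t ≤? M
  ... | yes t≤M = M , t≤M , rj≤M , reach
  ... | no t≰M with run-containing t
  ...   | r , s , R , r≤t , t≤s = v t , ≤-refl , ≤-trans rj≤M (<⇒≤ M<t) , reach′
    where
      M<t : M < v t
      M<t = ≰⇒> t≰M
      E-between : Between (r , s)
      E-between = run-between R r≤t t≤s si<t (≤-trans (≤-reflexive t+1≡u) u≤rj)
      reach′ : ∀ x → v rj ≤ x → x ≤ v t → Reach x
      reach′ x rj≤x x≤t with x ≤? M
      ... | yes x≤M = reach x rj≤x x≤M
      ... | no x≰M = inj₂ (prepend E-between (raise t+1≡u u≤M M<t R r≤t t≤s (<⇒≤ (≰⇒> x≰M)) x≤t)
                                   (raise t+1≡u u≤M M<t R r≤t t≤s ≤-refl (<⇒≤ M<t)) (reach M rj≤M ≤-refl))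

  covered : ∀ d (t : Fin n) → toℕ t + d ≡ toℕ rj → toℕ si < toℕ t → Covered t
  covered 0 t t≡rj _ = subst Covered (toℕ-injective (sym (trans (sym (+-identityʳ (toℕ t))) t≡rj))) covered-rj
  covered (1+ d) t e si<t with position (1+ (toℕ t)) (≤-<-trans t+1≤rj (toℕ<n rj))
    where
      t+1≤rj : 1+ (toℕ t) ≤ toℕ rj
      t+1≤rj = summand-≤ (1+ (toℕ t)) (trans (sym (+-suc (toℕ t) d)) e)
  ... | u , u≡t+1 = covered-step (sym u≡t+1) si<t (summand-≤ (toℕ u) u+d≡rj)
                      (covered d u u+d≡rj (<-trans si<t (subst (toℕ t <_) (sym u≡t+1) (n<1+n (toℕ t)))))
    where
      u+d≡rj : toℕ u + d ≡ toℕ rj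
      u+d≡rj = trans (cong (_+ d) u≡t+1) (trans (sym (+-suc (toℕ t) d)) e)

  si∈I : v si ∈I (ri , si)
  si∈I = run-interval Ri (IsDescRun.r≤s Ri) ≤-refl

  -- π_si is reachable when I(J) lies below it: si ends a run, so π_si < π_{si+1}
  reach-si : v rj < v si → Reach (v si)
  reach-si rj<si with position (1+ (toℕ si)) (≤-<-trans si<rj (toℕ<n rj))
  ... | c , c≡si+1 with covered (toℕ rj ∸ toℕ c) c (m+[n∸m]≡n (subst (_≤ toℕ rj) (sym c≡si+1) si<rj))
                                (subst (toℕ si <_) (sym c≡si+1) (n<1+n (toℕ si)))
  ...   | M , c≤M , _ , reach = reach (v si) (<⇒≤ rj<si) (≤-trans (<⇒≤ (IsDescRun.maxRight Ri c c≡si+1)) c≤M)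

  Linked : Set
  Linked = ∃ λ (k : ℕ) → Σ (Fin (1+ k) → Fin n × Fin n) λ D
    → (∀ a → Between (D a))
    × RunsMeet π (ri , si) (D zero)
    × RunsMeet π (D (fromℕ k)) (rj , sj)
    × (∀ (a : Fin k) → RunsMeet π (D (inject₁ a)) (D (suc a)))

  -- π_si is reachable but, for disjoint intervals, not inside I(J); its chain starts in I(I)
  linked : v rj < v si → ¬ Meet (v si) (v ri) (v sj) (v rj) → Linked
  linked rj<si disjoint with reach-si rj<si
  ... | inj₁ si∈J = ⊥-elim (disjoint (v si , si∈I , si∈J))
  ... | inj₂ (k , D , between , si∈D₀ , last , links) = k , D , between , (v si , si∈I , si∈D₀) , last , links

lemma2p3 : ∀ (n : ℕ) (π : Permutation′ n) (p q ri si rj sj : Fin n)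
    → toℕ p < toℕ q
    → val π q < val π p
    → IsDescRun π ri si → toℕ ri ≤ toℕ p → toℕ p ≤ toℕ si
    → IsDescRun π rj sj → toℕ rj ≤ toℕ q → toℕ q ≤ toℕ sj
    → ¬ (ri ≡ rj × si ≡ sj)
    → ¬ Meet (val π si) (val π ri) (val π sj) (val π rj)
    → ∃ λ (k : ℕ) → Σ (Fin (1+ k) → Fin n × Fin n) λ D
    → (∀ a → IsDescRun π (proj₁ (D a)) (proj₂ (D a))
    × toℕ si < toℕ (proj₁ (D a)) × toℕ (proj₂ (D a)) < toℕ rj)
    × RunsMeet π (ri , si) (D zero)
    × RunsMeet π (D (fromℕ k)) (rj , sj)
    × (∀ (a : Fin k) → RunsMeet π (D (inject₁ a)) (D (suc a)))
lemma2p3 n π p q ri si rj sj p<q q<p Ri ri≤p p≤si Rj rj≤q q≤sj distinct disjoint =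
  Linking.linked π ri si rj sj Ri Rj si<rj J-below-I disjoint
  where
    open Runs π
    si<rj : toℕ si < toℕ rj
    si<rj = distinct-runs-ordered π p<q Ri ri≤p Rj q≤sj distinct
    -- the inversion puts a value of J below one of I, so I(J) lies below I(I)
    J-below-I : v rj < v si
    J-below-I = disjoint-below (proj₁ (run-interval Ri ≤-refl (IsDescRun.r≤s Ri)))
                               (proj₁ (run-interval Rj ≤-refl (IsDescRun.r≤s Rj)))
                               (≤-trans (proj₁ (run-interval Rj rj≤q q≤sj))
                                        (≤-trans (<⇒≤ q<p) (proj₂ (run-interval Ri ri≤p p≤si))))
                               disjoint
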